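{- For every finite set $\mathcal{P}$ of process identifiers, every guarded recursive specification $\Delta$ over TSP with sequencing and every $X\in\mathcal{P}$, there exists a pushdown automaton $M$ with at most two states (and input alphabet $\mathit{Act}$) whose process graph $\mathcal{P}(M)$ is bisimilar to the process graph of $X$.
   Context: Process graphs and bisimilarity: a process graph is a tuple $(\mathcal{S},\mathcal{A},\to,\uparrow,\downarrow)$ with states $\mathcal{S}$, actions $\mathcal{A}$ (silent action $\tau\notin\mathcal{A}$), transitions $\to\subseteq\mathcal{S}\times(\mathcal{A}\cup\{\tau\})\times\mathcal{S}$, root $\uparrow$, accepting states $\downarrow\subseteq\mathcal{S}$. A bisimulation between two process graphs is a symmetric relation $R$ on the disjoint union of their states such that whenever $s\,R\,t$: if $s\xrightarrow{a}s'$ then $t\xrightarrow{a}t'$ for some $t'$ with $s'\,R\,t'$; and if $s$ is accepting so is $t$. Graphs are bisimilar if a bisimulation relates their roots. Pushdown automaton: $M=(\mathcal{S},\mathcal{A},\mathcal{D},\to,\uparrow,\downarrow)$ with finite state set $\mathcal{S}$, finite input alphabet $\mathcal{A}$ ($\tau\notin\mathcal{A}$), finite data alphabet $\mathcal{D}$, finite set of transitions $\to\subseteq\mathcal{S}\times(\mathcal{A}\cup\{\tau\})\times(\mathcal{D}\cup\{\epsilon\})\times\mathcal{D}^*\times\mathcal{S}$ (written $s\xrightarrow{a[d/x]}t$), initial state $\uparrow$, final states $\downarrow\subseteq\mathcal{S}$. Its process graph $\mathcal{P}(M)$ has states $(s,x)$, $s\in\mathcal{S}$, $x\in\mathcal{D}^*$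 (leftmost symbol = top of stack); $(s,dx)\xrightarrow{a}(s',x'x)$ iff $s\xrightarrow{a[d/x']}s'$ ($d\in\mathcal{D}$); $(s,\epsilon)\xrightarrow{a}(s',x)$ iff $s\xrightarrow{a[\epsilon/x]}s'$; root $(\uparrow,\epsilon)$; accepting states all $(s,x)$ with $s\in\downarrow$. TSP with sequencing: fix a finite set of actions $\mathit{Act}$ ($\tau\notin\mathit{Act}$) and a finite set $\mathcal{P}$ of identifiers. Expressions: $p::=0\mid 1\mid a.p\mid p+p\mid p;p\mid X$ ($a\in\mathit{Act}\cup\{\tau\}$, $X\in\mathcal{P}$). A recursive specification $\Delta$ assigns an expression $\Delta(X)$ to each $X\in\mathcal{P}$; it is guarded if every identifier occurrence in each right-hand side lies within the scope of an action prefix. Operational semantics: $1\downarrow$; $a.p\xrightarrow{a}p$; $(p+q)\downarrow$ if $p\downarrow$ or $q\downarrow$; $p+q\xrightarrow{a}p'$ if $p\xrightarrow{a}p'$ or $q\xrightarrow{a}p'$; $(p;q)\downarrow$ if $p\downarrow$ and $q\downarrow$; $p;q\xrightarrow{a}p';q$ if $p\xrightarrow{a}p'$; $p;q\xrightarrow{a}q'$ if $p\downarrow$, $p$ has no outgoing transitions, and $q\xrightarrow{a}q'$; $X\xrightarrow{a}p'$ if $\Delta(X)\xrightarrow{a}p'$; $X\downarrow$ if $\Delta(X)\downarrow$ (for guarded $\Delta$ these rules determine a unique transition relation). The process graph of $p$ has all expressions as states, this transition relation and acceptance predicate, and root $p$. -}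

module Defs where

open import Data.Nat using (ℕ)
open import Data.Fin using (Fin)
open import Data.Maybe using (Maybe; just; nothing)
open import Data.List using (List; []; _∷_; _++_)
open import Data.List.Membership.Propositional using (_∈_)
open import Data.Bool using (Bool; true)
open import Data.Product using (Σ; _×_; _,_)
open import Data.Sum using (_⊎_; inj₁; inj₂)
open import Data.Empty using (⊥)
open import Data.Unit using (⊤)
open import Relation.Nullary using (¬_)
open import Relation.Binary.PropositionalEquality using (_≡_)
open import Function.Bundles using (_⇔_)

Label : Set → Set
Label A = Maybe A

τ : {A : Set} → Label A
τ = nothing

record ProcessGraph (A : Set) : Set₁ where
  field
    State     : Set
    Step      : State → Label A → State → Set
    root      : State
    accepting : State → Set

open ProcessGraph public

module _ {A : Set} (G H : ProcessGraph A) where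

  UState : Set
  UState = State G ⊎ State H

  UStep : UState → Label A → UState → Set
  UStep (inj₁ s) a (inj₁ s') = Step G s a s'
  UStep (inj₂ t) a (inj₂ t') = Step H t a t'
  UStep _        _ _         = ⊥

  UAcc : UState → Set
  UAcc (inj₁ s) = accepting G s
  UAcc (inj₂ t) = accepting H t

  record IsBisimulation (R : UState → UState → Set) : Set where
    field
      symm     : ∀ {u v} → R u v → R v u
      transfer : ∀ {u v a u'} → R u v → UStep u a u' →
                 Σ UState λ v' → UStep v a v' × R u' v'
      accept   : ∀ {u v} → R u v → UAcc u → UAcc v

  Bisimilar : Set₁
  Bisimilar = Σ (UState → UState → Set) λ R →
                IsBisimulation R × R (inj₁ (root G)) (inj₂ (root H))

-- Pushdown automata with input alphabet Fin nA, finite state set Fin nS,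
-- finite data alphabet Fin nD, finite list of transitions
-- (s , a , d-or-ε , x , t)  meaning  s --a[d/x]--> t

record PDA (nA : ℕ) : Set where
  field
    nS    : ℕ
    nD    : ℕ
    trans : List (Fin nS × Label (Fin nA) × Maybe (Fin nD) × List (Fin nD) × Fin nS)
    init  : Fin nS
    final : Fin nS → Bool

open PDA public

module _ {nA : ℕ} (M : PDA nA) where

  PConf : Set
  PConf = Fin (nS M) × List (Fin (nD M))

  PStep : PConf → Label (Fin nA) → PConf → Set
  PStep (s , d ∷ x) a (s' , y) =
    Σ (List (Fin (nD M))) λ x' → ((s , a , just d , x' , s') ∈ trans M) × (y ≡ x' ++ x)
  PStep (s , []) a (s' , y) = (s , a , nothing , y , s') ∈ trans M

  pdaGraph : ProcessGraph (Fin nA)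
  pdaGraph = record
    { State     = PConf
    ; Step      = PStep
    ; root      = (init M , [])
    ; accepting = λ c → final M (Data.Product.proj₁ c) ≡ true
    }

infixr 7 _∙_
infixl 5 _⊕_
infixl 6 _⨾_

data Exp (nA nP : ℕ) : Set where
  𝟘   : Exp nA nP
  𝟙   : Exp nA nP
  _∙_ : Label (Fin nA) → Exp nA nP → Exp nA nP
  _⊕_ : Exp nA nP → Exp nA nP → Exp nA nP
  _⨾_ : Exp nA nP → Exp nA nP → Exp nA nP
  var : Fin nP → Exp nA nP

Spec : ℕ → ℕ → Set
Spec nA nP = Fin nP → Exp nA nP

GuardedExp : {nA nP : ℕ} → Exp nA nP → Set
GuardedExp 𝟘       = ⊤
GuardedExp 𝟙       = ⊤
GuardedExp (a ∙ p) = ⊤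
GuardedExp (p ⊕ q) = GuardedExp p × GuardedExp q
GuardedExp (p ⨾ q) = GuardedExp p × GuardedExp q
GuardedExp (var X) = ⊥

Guarded : {nA nP : ℕ} → Spec nA nP → Set
Guarded Δ = ∀ X → GuardedExp (Δ X)

-- The SOS rules, read as: the premises that justify a transition /
-- termination, given a candidate transition relation T and predicate ↓.
module _ {nA nP : ℕ} (Δ : Spec nA nP)
         (T : Exp nA nP → Label (Fin nA) → Exp nA nP → Set)
         (↓ : Exp nA nP → Set) where

  TermRule : Exp nA nP → Set
  TermRule 𝟘       = ⊥
  TermRule 𝟙       = ⊤
  TermRule (a ∙ p) = ⊥
  TermRule (p ⊕ q) = ↓ p ⊎ ↓ q
  TermRule (p ⨾ q) = ↓ p × ↓ q
  TermRule (var X) = ↓ (Δ X)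

  StepRule : Exp nA nP → Label (Fin nA) → Exp nA nP → Set
  StepRule 𝟘       a r = ⊥
  StepRule 𝟙       a r = ⊥
  StepRule (b ∙ p) a r = (a ≡ b) × (r ≡ p)
  StepRule (p ⊕ q) a r = T p a r ⊎ T q a r
  StepRule (p ⨾ q) a r =
    (Σ (Exp nA nP) λ p' → T p a p' × (r ≡ (p' ⨾ q)))
    ⊎ (↓ p × (∀ b p'' → ¬ T p b p'') × T q a r)
  StepRule (var X) a r = T (Δ X) a r

-- A transition relation and termination predicate determined by the rules
-- (exactly the rule instances hold).  For guarded Δ there is a unique one.
record SOSModel {nA nP : ℕ} (Δ : Spec nA nP) : Set₁ where
  field
    _⟶[_]_ : Exp nA nP → Label (Fin nA) → Exp nA nP → Set
    _↓     : Exp nA nP → Set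
    stepRules : ∀ p a r → (p ⟶[ a ] r) ⇔ StepRule Δ _⟶[_]_ _↓ p a r
    termRules : ∀ p → (p ↓) ⇔ TermRule Δ _⟶[_]_ _↓ p

open SOSModel public

expGraph : {nA nP : ℕ} {Δ : Spec nA nP} → SOSModel Δ → Exp nA nP → ProcessGraph (Fin nA)
expGraph m p = record
  { State     = Exp _ _
  ; Step      = _⟶[_]_ m
  ; root      = p
  ; accepting = _↓ m
  }

-- Every state reachable from X is a left-nested sequential composition x ⨾ z₁ ⨾ ⋯ ⨾ zₖ whose
-- components come from a finite set U: the identifiers and the subterms of their right-hand sides.
-- Such a composition moves only through its first non-trivial component (a trivial one terminates
-- and is stuck, like 1), and a step of that component to r replaces it by the components of r.
-- So a pushdown automaton whose stack lists the non-trivial components, as positions in U, mimics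
-- it step for step: pop the top component, push the non-trivial components of the target.
-- Guardedness makes every expression finitely branching with decidable termination, hence finitely
-- many rules. The control state records whether all components terminate; a pop has to restore
-- this bit for the remaining stack, so each cell also stores it for the cells below it, and two
-- control states suffice.

module Submission where

open import Defs hiding (_⟶[_]_; _↓; trans)
open import Data.Nat using (ℕ; suc; _≤_; s≤s; z≤n; _*_)
open import Data.Fin using (Fin; zero; suc; combine)
open import Data.Fin.Properties using (2↔Bool; combine-injective; suc-injective)
open import Data.Bool using (Bool; true; false; _∧_)
open import Data.Maybe using (Maybe; just; nothing)
open import Data.Product as Product using (Σ; ∃; _×_; _,_; proj₁; proj₂)
open import Data.Sum as Sum using (inj₁; inj₂)
open import Data.Empty using (⊥; ⊥-elim)
open import Data.Unit using (tt)
open import Data.List using (List; []; _∷_; _++_; map; foldl; foldr; filter; concatMap; allFin; length; lookup)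
open import Data.List.NonEmpty using (List⁺; _∷_; toList; _⁺++_)
open import Data.List.Properties using (foldl-++; foldr-++; filter-++; map-++; ++-assoc)
open import Data.List.Relation.Unary.All as All using (All; []; _∷_)
import Data.List.Relation.Unary.All.Properties as Allₚ
open import Data.List.Relation.Unary.Any as Any using (here; there)
open import Data.List.Relation.Unary.Any.Properties using (lookup-index; mapWith∈⁺; mapWith∈⁻)
open import Data.List.Membership.Propositional using (_∈_; lose; find; mapWith∈)
open import Data.List.Membership.Propositional.Properties using (∈-++⁺ˡ; ∈-++⁺ʳ; ∈-++⁻; ∈-map⁺; ∈-map⁻)
open import Data.List.Membership.Propositional.Properties using (∈-filter⁻; ∈-filter⁺; ∈-concatMap⁺; ∈-concatMap⁻)
open import Data.List.Membership.Propositional.Properties using (∈-allFin; ∈-lookup)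
open import Data.List.Relation.Binary.Subset.Propositional using (_⊆_)
open import Data.List.Relation.Binary.Subset.Propositional.Properties using (⊆-refl; xs⊆xs++ys; xs⊆ys++xs)
open import Relation.Nullary using (¬_; Dec; yes; no; does; ¬?)
open import Relation.Nullary.Decidable using (map′; _×-dec_; _⊎-dec_)
open import Relation.Unary using (Decidable)
open import Relation.Binary.PropositionalEquality using (_≡_; refl; sym; trans; cong; cong₂; subst; module ≡-Reasoning)
open import Function using (_∘_; case_of_)
open import Function.Bundles using (_⇔_; mk⇔; Equivalence; Inverse)
import Function.Properties.Equivalence as ⇔

module _ {A : Set} (G H : ProcessGraph A) where

  record IsBisimulationBetween (R : State G → State H → Set) : Set where
    field
      forth  : ∀ {s t a s′} → R s t → Step G s a s′ → Σ (State H) λ t′ → Step H t a t′ × R s′ t′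
      back   : ∀ {s t a t′} → R s t → Step H t a t′ → Σ (State G) λ s′ → Step G s a s′ × R s′ t′
      accept : ∀ {s t} → R s t → accepting G s ⇔ accepting H t

  bisimilar : ∀ {R} → IsBisimulationBetween R → R (root G) (root H) → Bisimilar G H
  bisimilar {R} isBisim root∼root = R⇄ , isBisimulation , root∼root
    where
    open IsBisimulationBetween isBisim

    R⇄ : UState G H → UState G H → Set
    R⇄ (inj₁ s) (inj₂ t) = R s t
    R⇄ (inj₂ t) (inj₁ s) = R s t
    R⇄ _        _        = ⊥

    isBisimulation : IsBisimulation G H R⇄
    IsBisimulation.symm isBisimulation {inj₁ _} {inj₂ _} s∼t = s∼t
    IsBisimulation.symm isBisimulation {inj₂ _} {inj₁ _} s∼t = s∼t
    IsBisimulation.transfer isBisimulation {inj₁ _} {inj₂ _} {u' = inj₁ _} s∼t step with forth s∼t step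
    ... | t′ , step′ , s′∼t′ = inj₂ t′ , step′ , s′∼t′
    IsBisimulation.transfer isBisimulation {inj₂ _} {inj₁ _} {u' = inj₂ _} s∼t step with back s∼t step
    ... | s′ , step′ , s′∼t′ = inj₁ s′ , step′ , s′∼t′
    IsBisimulation.accept isBisimulation {inj₁ _} {inj₂ _} = Equivalence.to ∘ accept
    IsBisimulation.accept isBisimulation {inj₂ _} {inj₁ _} = Equivalence.from ∘ accept

does-≡-true : ∀ {P : Set} (P? : Dec P) → does P? ≡ true ⇔ P
does-≡-true (yes p) = mk⇔ (λ _ → p) (λ _ → refl)
does-≡-true (no ¬p) = mk⇔ (λ ()) (⊥-elim ∘ ¬p)

module _ {A : Set} (ys : List A) where

  indices : (xs : List A) → xs ⊆ ys → List (Fin (length ys))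
  indices []       _   = []
  indices (x ∷ xs) xs⊆ = Any.index (xs⊆ (here refl)) ∷ indices xs (xs⊆ ∘ there)

  lookup-indices : ∀ xs (xs⊆ : xs ⊆ ys) → map (lookup ys) (indices xs xs⊆) ≡ xs
  lookup-indices []       _   = refl
  lookup-indices (x ∷ xs) xs⊆ =
    cong₂ _∷_ (sym (lookup-index (xs⊆ (here refl)))) (lookup-indices xs (xs⊆ ∘ there))

module _ {nA nP : ℕ} where

  private variable
    e x : Exp nA nP

  seq : Exp nA nP → List (Exp nA nP) → Exp nA nP
  seq = foldl _⨾_

  seq⁺ : List⁺ (Exp nA nP) → Exp nA nP
  seq⁺ (x ∷ zs) = seq x zs

  seq⁺-⁺++ : ∀ xs ys → seq⁺ (xs ⁺++ ys) ≡ seq (seq⁺ xs) ys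
  seq⁺-⁺++ (x ∷ zs) = foldl-++ _⨾_ x zs

  spine : Exp nA nP → List⁺ (Exp nA nP)
  spine (p ⨾ q) = spine p ⁺++ q ∷ []
  spine e       = e ∷ []

  seq⁺-spine : ∀ e → seq⁺ (spine e) ≡ e
  seq⁺-spine 𝟘       = refl
  seq⁺-spine 𝟙       = refl
  seq⁺-spine (a ∙ p) = refl
  seq⁺-spine (p ⊕ q) = refl
  seq⁺-spine (p ⨾ q) = trans (seq⁺-⁺++ (spine p) (q ∷ [])) (cong (_⨾ q) (seq⁺-spine p))
  seq⁺-spine (var Y) = refl

  properSubterms : Exp nA nP → List (Exp nA nP)
  properSubterms (a ∙ p) = p ∷ properSubterms p
  properSubterms (p ⊕ q) = (p ∷ properSubterms p) ++ (q ∷ properSubterms q)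
  properSubterms (p ⨾ q) = (p ∷ properSubterms p) ++ (q ∷ properSubterms q)
  properSubterms _       = []

  subterms : Exp nA nP → List (Exp nA nP)
  subterms e = e ∷ properSubterms e

  mutual
    subterms-⊆ : x ∈ subterms e → subterms x ⊆ subterms e
    subterms-⊆ (here refl)              = ⊆-refl
    subterms-⊆ {e = a ∙ p} (there x∈)   = there ∘ subterms-⊆ x∈
    subterms-⊆ {e = p ⊕ q} (there x∈)   = there ∘ subterms-⊆-++ p q x∈
    subterms-⊆ {e = p ⨾ q} (there x∈)   = there ∘ subterms-⊆-++ p q x∈

    subterms-⊆-++ : ∀ p q → x ∈ subterms p ++ subterms q → subterms x ⊆ subterms p ++ subterms q
    subterms-⊆-++ p q x∈ with ∈-++⁻ (subterms p) x∈
    ... | inj₁ x∈p = xs⊆xs++ys _ _ ∘ subterms-⊆ x∈p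
    ... | inj₂ x∈q = xs⊆ys++xs _ (subterms p) ∘ subterms-⊆ x∈q

  spine-⊆ : ∀ e → toList (spine e) ⊆ subterms e
  spine-⊆ (p ⨾ q) x∈ with ∈-++⁻ (toList (spine p)) x∈
  ... | inj₁ x∈p          = there (xs⊆xs++ys _ _ (spine-⊆ p x∈p))
  ... | inj₂ (here refl)  = there (∈-++⁺ʳ (subterms p) (here refl))
  spine-⊆ 𝟘       (here refl) = here refl
  spine-⊆ 𝟙       (here refl) = here refl
  spine-⊆ (a ∙ p) (here refl) = here refl
  spine-⊆ (p ⊕ q) (here refl) = here refl
  spine-⊆ (var Y) (here refl) = here refl

  module _ (Δ : Spec nA nP) where

    definitionSubterms : Fin nP → List (Exp nA nP)
    definitionSubterms Y = subterms (var Y) ++ subterms (Δ Y)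

    specSubterms : List (Exp nA nP)
    specSubterms = concatMap definitionSubterms (allFin nP)

    definitionSubterms-⊆ : ∀ Y → definitionSubterms Y ⊆ specSubterms
    definitionSubterms-⊆ Y x∈ = ∈-concatMap⁺ definitionSubterms (lose (∈-allFin Y) x∈)

    var∈specSubterms : ∀ Y → var Y ∈ specSubterms
    var∈specSubterms Y = definitionSubterms-⊆ Y (here refl)

    body-⊆-specSubterms : ∀ Y → subterms (Δ Y) ⊆ specSubterms
    body-⊆-specSubterms Y = definitionSubterms-⊆ Y ∘ xs⊆ys++xs _ (subterms (var Y))

    specSubterms-closed : e ∈ specSubterms → subterms e ⊆ specSubterms
    specSubterms-closed e∈ with find (∈-concatMap⁻ definitionSubterms {xs = allFin nP} e∈)
    ... | Y , _ , e∈Y = definitionSubterms-⊆ Y ∘ subterms-⊆-++ (var Y) (Δ Y) e∈Y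

module SOS {nA nP : ℕ} {Δ : Spec nA nP} (m : SOSModel Δ) where

  open SOSModel m public using (_⟶[_]_; _↓)

  private variable
    a : Label (Fin nA)
    f p q r x x′ : Exp nA nP
    zs : List (Exp nA nP)

  step⁺ : StepRule Δ _⟶[_]_ _↓ p a r → p ⟶[ a ] r
  step⁺ = Equivalence.from (stepRules m _ _ _)

  step⁻ : p ⟶[ a ] r → StepRule Δ _⟶[_]_ _↓ p a r
  step⁻ = Equivalence.to (stepRules m _ _ _)

  term⁺ : TermRule Δ _⟶[_]_ _↓ p → p ↓
  term⁺ = Equivalence.from (termRules m _)

  term⁻ : p ↓ → TermRule Δ _⟶[_]_ _↓ p
  term⁻ = Equivalence.to (termRules m _)

  Stuck : Exp nA nP → Set
  Stuck p = ∀ a r → ¬ p ⟶[ a ] r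

  Trivial : Exp nA nP → Set
  Trivial p = p ↓ × Stuck p

  infix 4 _≃_
  record _≃_ (p q : Exp nA nP) : Set where
    field
      steps-⇔ : ∀ {a r} → p ⟶[ a ] r ⇔ q ⟶[ a ] r
      ↓-⇔     : p ↓ ⇔ q ↓
  open _≃_ public

  ≃-refl : p ≃ p
  ≃-refl = record { steps-⇔ = ⇔.refl ; ↓-⇔ = ⇔.refl }

  ≃-sym : p ≃ q → q ≃ p
  ≃-sym p≃q = record { steps-⇔ = ⇔.sym (steps-⇔ p≃q) ; ↓-⇔ = ⇔.sym (↓-⇔ p≃q) }

  ≃-trans : p ≃ q → q ≃ r → p ≃ r
  ≃-trans p≃q q≃r = record
    { steps-⇔ = ⇔.trans (steps-⇔ p≃q) (steps-⇔ q≃r) ; ↓-⇔ = ⇔.trans (↓-⇔ p≃q) (↓-⇔ q≃r) }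

  Stuck-≃ : p ≃ q → Stuck p → Stuck q
  Stuck-≃ p≃q p-stuck a r tq = p-stuck a r (Equivalence.from (steps-⇔ p≃q) tq)

  ⨾-≃ : ∀ s → p ≃ q → p ⨾ s ≃ q ⨾ s
  ⨾-≃ s p≃q = record
    { steps-⇔ = mk⇔ (⨾-step p≃q) (⨾-step (≃-sym p≃q))
    ; ↓-⇔ = mk⇔ (⨾-term p≃q) (⨾-term (≃-sym p≃q))
    }
    where
    ⨾-step : ∀ {p q a r} → p ≃ q → (p ⨾ s) ⟶[ a ] r → (q ⨾ s) ⟶[ a ] r
    ⨾-step p≃q t with step⁻ t
    ... | inj₁ (p′ , tp , refl)       = step⁺ (inj₁ (p′ , Equivalence.to (steps-⇔ p≃q) tp , refl))
    ... | inj₂ (p↓ , p-stuck , ts)    = step⁺ (inj₂ (Equivalence.to (↓-⇔ p≃q) p↓ , Stuck-≃ p≃q p-stuck , ts))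

    ⨾-term : ∀ {p q} → p ≃ q → (p ⨾ s) ↓ → (q ⨾ s) ↓
    ⨾-term p≃q t with term⁻ t
    ... | p↓ , s↓ = term⁺ (Equivalence.to (↓-⇔ p≃q) p↓ , s↓)

  seq-≃ : ∀ zs → p ≃ q → seq p zs ≃ seq q zs
  seq-≃ []       p≃q = p≃q
  seq-≃ (z ∷ zs) p≃q = seq-≃ zs (⨾-≃ z p≃q)

  Trivial-≃ : p ≃ q → Trivial p → Trivial q
  Trivial-≃ p≃q (p↓ , p-stuck) = Equivalence.to (↓-⇔ p≃q) p↓ , Stuck-≃ p≃q p-stuck

  Trivial-⨾ : Trivial p → p ⨾ q ≃ q
  Trivial-⨾ {p = p} {q = q} (p↓ , p-stuck) = record
    { steps-⇔ = mk⇔ right-step (λ tq → step⁺ (inj₂ (p↓ , p-stuck , tq)))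
    ; ↓-⇔ = mk⇔ (proj₂ ∘ term⁻) (λ q↓ → term⁺ (p↓ , q↓))
    }
    where
    right-step : ∀ {a r} → (p ⨾ q) ⟶[ a ] r → q ⟶[ a ] r
    right-step t with step⁻ t
    ... | inj₁ (p′ , tp , _) = ⊥-elim (p-stuck _ p′ tp)
    ... | inj₂ (_ , _ , tq)  = tq

  ¬Trivial-⨾ : ∀ q → ¬ Trivial p → ¬ Trivial (p ⨾ q)
  ¬Trivial-⨾ q p-active (pq↓ , pq-stuck) =
    p-active (proj₁ (term⁻ pq↓) , λ a p′ tp → pq-stuck a (p′ ⨾ q) (step⁺ (inj₁ (p′ , tp , refl))))

  ⨾-step⁻ : ¬ Trivial p → (p ⨾ q) ⟶[ a ] r → ∃ λ p′ → p ⟶[ a ] p′ × r ≡ p′ ⨾ q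
  ⨾-step⁻ p-active t with step⁻ t
  ... | inj₁ left-step          = left-step
  ... | inj₂ (p↓ , p-stuck , _) = ⊥-elim (p-active (p↓ , p-stuck))

  seq-step⁻ : ∀ zs → ¬ Trivial x → seq x zs ⟶[ a ] r → ∃ λ x′ → x ⟶[ a ] x′ × r ≡ seq x′ zs
  seq-step⁻ []       x-active t = _ , t , refl
  seq-step⁻ (z ∷ zs) x-active t with seq-step⁻ zs (¬Trivial-⨾ z x-active) t
  ... | _ , t′ , refl with ⨾-step⁻ x-active t′
  ...   | x′ , tx , refl = x′ , tx , refl

  seq-step⁺ : ∀ zs → x ⟶[ a ] x′ → seq x zs ⟶[ a ] seq x′ zs
  seq-step⁺ []       t = t
  seq-step⁺ (z ∷ zs) t = seq-step⁺ zs (step⁺ (inj₁ (_ , t , refl)))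

  seq-↓ : ∀ zs → seq x zs ↓ ⇔ All _↓ (x ∷ zs)
  seq-↓ zs = mk⇔ (to zs) (from zs)
    where
    to : ∀ {x} zs → seq x zs ↓ → All _↓ (x ∷ zs)
    to []       x↓ = x↓ ∷ []
    to (z ∷ zs) t with to zs t
    ... | xz↓ ∷ zs↓ = proj₁ (term⁻ xz↓) ∷ proj₂ (term⁻ xz↓) ∷ zs↓

    from : ∀ {x} zs → All _↓ (x ∷ zs) → seq x zs ↓
    from []       (x↓ ∷ [])       = x↓
    from (z ∷ zs) (x↓ ∷ z↓ ∷ zs↓) = from zs (term⁺ (x↓ , z↓) ∷ zs↓)

  module DropTrivial (trivial? : Decidable Trivial) where

    active? : Decidable (¬_ ∘ Trivial)
    active? = ¬? ∘ trivial?

    dropTrivial : List (Exp nA nP) → List (Exp nA nP)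
    dropTrivial = filter active?

    dropTrivial-⊆ : dropTrivial zs ⊆ zs
    dropTrivial-⊆ = proj₁ ∘ ∈-filter⁻ active?

    All-↓-dropTrivial : All _↓ (dropTrivial zs) ⇔ All _↓ zs
    All-↓-dropTrivial = mk⇔ (λ active↓ → All.tabulate (member↓ active↓)) (Allₚ.filter⁺ active?)
      where
      member↓ : All _↓ (dropTrivial zs) → x ∈ zs → x ↓
      member↓ {x = x} active↓ x∈ with trivial? x
      ... | yes (x↓ , _) = x↓
      ... | no x-active  = All.lookup active↓ (∈-filter⁺ active? x∈ x-active)

    dropTrivial-≡[] : ∀ x zs → dropTrivial (x ∷ zs) ≡ [] → Trivial (seq x zs)
    dropTrivial-≡[] x zs none-active with trivial? x
    dropTrivial-≡[] x []       _           | yes x-trivial = x-trivial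
    dropTrivial-≡[] x (z ∷ zs) none-active | yes x-trivial =
      Trivial-≃ (≃-sym (seq-≃ zs (Trivial-⨾ x-trivial))) (dropTrivial-≡[] z zs none-active)

    dropTrivial-≡∷ : ∀ x zs {fs} → dropTrivial (x ∷ zs) ≡ f ∷ fs →
                     ∃ λ post → ¬ Trivial f × seq x zs ≃ seq f post × dropTrivial post ≡ fs
    dropTrivial-≡∷ x zs first-active with trivial? x
    dropTrivial-≡∷ x zs       refl | no x-active = zs , x-active , ≃-refl , refl
    dropTrivial-≡∷ x (z ∷ zs) first-active | yes x-trivial with dropTrivial-≡∷ z zs first-active
    ... | post , f-active , z⨾zs≃f⨾post , rest =
      post , f-active , ≃-trans (seq-≃ zs (Trivial-⨾ x-trivial)) z⨾zs≃f⨾post , rest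

module _ {nA nP : ℕ} {Δ : Spec nA nP} (guarded : Guarded Δ) {P : Exp nA nP → Set}
         (P-𝟘 : P 𝟘) (P-𝟙 : P 𝟙) (P-∙ : ∀ a p → P (a ∙ p))
         (P-⊕ : ∀ {p q} → P p → P q → P (p ⊕ q)) (P-⨾ : ∀ {p q} → P p → P q → P (p ⨾ q))
         (P-var : ∀ {Y} → P (Δ Y) → P (var Y)) where

  -- A guarded body reaches identifiers only under prefixes, where no hypothesis is used.
  private
    guardedBody : ∀ e → GuardedExp e → P e
    guardedBody 𝟘       _         = P-𝟘
    guardedBody 𝟙       _         = P-𝟙
    guardedBody (a ∙ p) _         = P-∙ a p
    guardedBody (p ⊕ q) (gp , gq) = P-⊕ (guardedBody p gp) (guardedBody q gq)
    guardedBody (p ⨾ q) (gp , gq) = P-⨾ (guardedBody p gp) (guardedBody q gq)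

  guardedInduction : ∀ e → P e
  guardedInduction 𝟘       = P-𝟘
  guardedInduction 𝟙       = P-𝟙
  guardedInduction (a ∙ p) = P-∙ a p
  guardedInduction (p ⊕ q) = P-⊕ (guardedInduction p) (guardedInduction q)
  guardedInduction (p ⨾ q) = P-⨾ (guardedInduction p) (guardedInduction q)
  guardedInduction (var Y) = P-var (guardedBody (Δ Y) (guarded Y))

module GuardedSpecification {nA nP : ℕ} {Δ : Spec nA nP} (guarded : Guarded Δ) (m : SOSModel Δ) where

  open SOS m

  private variable
    a : Label (Fin nA)
    e p q r : Exp nA nP

  record Branching (e : Exp nA nP) : Set where
    field
      terminates?    : Dec (e ↓)
      steps          : List (Label (Fin nA) × Exp nA nP)
      steps-complete : e ⟶[ a ] r → (a , r) ∈ steps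
      steps-sound    : (a , r) ∈ steps → e ⟶[ a ] r
  open Branching public

  stuck? : Branching e → Dec (Stuck e)
  stuck? b with steps b | steps-complete b | steps-sound b
  ... | []          | complete | _     = yes λ _ _ t → case complete t of λ ()
  ... | (a , r) ∷ _ | _        | sound = no λ stuck → stuck a r (sound (here refl))

  trivial?ᵇ : Branching e → Dec (Trivial e)
  trivial?ᵇ b = terminates? b ×-dec stuck? b

  branching-𝟘 : Branching 𝟘
  branching-𝟘 = record
    { terminates? = no term⁻ ; steps = [] ; steps-complete = ⊥-elim ∘ step⁻ ; steps-sound = λ () }

  branching-𝟙 : Branching 𝟙
  branching-𝟙 = record
    { terminates? = yes (term⁺ tt) ; steps = [] ; steps-complete = ⊥-elim ∘ step⁻ ; steps-sound = λ () }

  branching-∙ : ∀ b p → Branching (b ∙ p)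
  branching-∙ b p = record
    { terminates?    = no term⁻
    ; steps          = (b , p) ∷ []
    ; steps-complete = λ t → case step⁻ t of λ { (refl , refl) → here refl }
    ; steps-sound    = λ { (here refl) → step⁺ (refl , refl) }
    }

  branching-⊕ : Branching p → Branching q → Branching (p ⊕ q)
  branching-⊕ bp bq = record
    { terminates?    = map′ term⁺ term⁻ (terminates? bp ⊎-dec terminates? bq)
    ; steps          = steps bp ++ steps bq
    ; steps-complete = Sum.[ ∈-++⁺ˡ ∘ steps-complete bp , ∈-++⁺ʳ _ ∘ steps-complete bq ] ∘ step⁻
    ; steps-sound    = step⁺ ∘ Sum.map (steps-sound bp) (steps-sound bq) ∘ ∈-++⁻ (steps bp)
    }

  branching-⨾ : Branching p → Branching q → Branching (p ⨾ q)
  branching-⨾ {p} {q} bp bq = record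
    { terminates?    = map′ term⁺ term⁻ (terminates? bp ×-dec terminates? bq)
    ; steps          = map (Product.map₂ (_⨾ q)) (steps bp) ++ handover (trivial?ᵇ bp)
    ; steps-complete = complete
    ; steps-sound    = sound
    }
    where
    handover : Dec (Trivial p) → List (Label (Fin nA) × Exp nA nP)
    handover (yes _) = steps bq
    handover (no _)  = []

    complete : (p ⨾ q) ⟶[ a ] r → (a , r) ∈ map (Product.map₂ (_⨾ q)) (steps bp) ++ handover (trivial?ᵇ bp)
    complete t with step⁻ t | trivial?ᵇ bp
    ... | inj₁ (p′ , tp , refl)    | _             = ∈-++⁺ˡ (∈-map⁺ _ (steps-complete bp tp))
    ... | inj₂ (_ , _ , tq)        | yes _         = ∈-++⁺ʳ _ (steps-complete bq tq)
    ... | inj₂ (p↓ , p-stuck , _)  | no p-active   = ⊥-elim (p-active (p↓ , p-stuck))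

    sound : (a , r) ∈ map (Product.map₂ (_⨾ q)) (steps bp) ++ handover (trivial?ᵇ bp) → (p ⨾ q) ⟶[ a ] r
    sound k with trivial?ᵇ bp
    ... | decision with ∈-++⁻ (map (Product.map₂ (_⨾ q)) (steps bp)) k
    ...   | inj₁ k′ with ∈-map⁻ _ k′
    ...     | (_ , p′) , k″ , refl = step⁺ (inj₁ (p′ , steps-sound bp k″ , refl))
    sound k | yes (p↓ , p-stuck) | inj₂ k′ = step⁺ (inj₂ (p↓ , p-stuck , steps-sound bq k′))

  branching-var : ∀ {Y} → Branching (Δ Y) → Branching (var Y)
  branching-var b = record
    { terminates?    = map′ term⁺ term⁻ (terminates? b)
    ; steps          = steps b
    ; steps-complete = steps-complete b ∘ step⁻
    ; steps-sound    = step⁺ ∘ steps-sound b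
    }

  -- Opaque: unfolding these decision procedures inside the automaton's rule lists makes type checking infeasible.
  opaque
    branching : ∀ e → Branching e
    branching = guardedInduction guarded
      branching-𝟘 branching-𝟙 branching-∙ branching-⊕ branching-⨾ branching-var

  trivial? : Decidable Trivial
  trivial? = trivial?ᵇ ∘ branching

  module _ (U : List (Exp nA nP)) (bodies-⊆ : ∀ Y → subterms (Δ Y) ⊆ U) where

    private
      Closed : Exp nA nP → Set
      Closed e = subterms e ⊆ U → ∀ {a r} → e ⟶[ a ] r → toList (spine r) ⊆ U

      closed-∙ : ∀ b p → Closed (b ∙ p)
      closed-∙ b p sub t with step⁻ t
      ... | refl , refl = sub ∘ there ∘ spine-⊆ p

      closed-⊕ : Closed p → Closed q → Closed (p ⊕ q)
      closed-⊕ {p} closed-p closed-q sub t with step⁻ t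
      ... | inj₁ tp = closed-p (sub ∘ there ∘ xs⊆xs++ys _ _) tp
      ... | inj₂ tq = closed-q (sub ∘ there ∘ xs⊆ys++xs _ (subterms p)) tq

      closed-⨾ : Closed p → Closed q → Closed (p ⨾ q)
      closed-⨾ {p} closed-p closed-q sub t x∈ with step⁻ t
      ... | inj₂ (_ , _ , tq)     = closed-q (sub ∘ there ∘ xs⊆ys++xs _ (subterms p)) tq x∈
      ... | inj₁ (p′ , tp , refl) with ∈-++⁻ (toList (spine p′)) x∈
      ...   | inj₁ x∈p′       = closed-p (sub ∘ there ∘ xs⊆xs++ys _ _) tp x∈p′
      ...   | inj₂ (here refl) = sub (there (∈-++⁺ʳ (subterms p) (here refl)))

    spine-target-⊆ : ∀ e → subterms e ⊆ U → ∀ {a r} → e ⟶[ a ] r → toList (spine r) ⊆ U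
    spine-target-⊆ = guardedInduction guarded
      (λ _ → ⊥-elim ∘ step⁻) (λ _ → ⊥-elim ∘ step⁻) closed-∙ closed-⊕ closed-⨾
      (λ {Y} closed-Δ _ → closed-Δ (bodies-⊆ Y) ∘ step⁻)

module Construction {nA nP : ℕ} {Δ : Spec nA nP} (guarded : Guarded Δ) (m : SOSModel Δ)
                    (U : List (Exp nA nP)) (U-closed : ∀ {e} → e ∈ U → subterms e ⊆ U)
                    (bodies-⊆ : ∀ Y → subterms (Δ Y) ⊆ U) (X : Fin nP) (var∈U : var X ∈ U) where

  open SOS m
  open GuardedSpecification guarded m
  open DropTrivial trivial?
  open Inverse 2↔Bool using ()
    renaming (to to toBool; from to fromBool; strictlyInverseˡ to toBool-fromBool)

  private variable
    a : Label (Fin nA)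
    e r : Exp nA nP

  n : ℕ
  n = length U

  U[_] : Fin n → Exp nA nP
  U[ i ] = lookup U i

  targetCells : e ∈ U → e ⟶[ a ] r → List (Fin n)
  targetCells {e} {r = r} e∈U t =
    indices U (dropTrivial (toList (spine r))) (spine-target-⊆ U bodies-⊆ e (U-closed e∈U) t ∘ dropTrivial-⊆)

  lookup-targetCells : (e∈U : e ∈ U) (t : e ⟶[ a ] r) →
                       map U[_] (targetCells e∈U t) ≡ dropTrivial (toList (spine r))
  lookup-targetCells {r = r} e∈U t = lookup-indices U (dropTrivial (toList (spine r))) _

  nData : ℕ
  nData = suc (n * 2)

  -- The bottom marker keeps the stack non-empty after the first step, so the start rules,
  -- which pop from the empty stack, fire only at the root.
  bottom : Fin nData
  bottom = zero

  cell : Fin n → Bool → Fin nData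
  cell i b = suc (combine i (fromBool b))

  cell-injective : ∀ {i j b c} → cell i b ≡ cell j c → i ≡ j × b ≡ c
  cell-injective {i} {j} {b} {c} eq with combine-injective i (fromBool b) j (fromBool c) (suc-injective eq)
  ... | i≡j , b≡c = i≡j , (begin
    b                  ≡⟨ toBool-fromBool b ⟨
    toBool (fromBool b) ≡⟨ cong toBool b≡c ⟩
    toBool (fromBool c) ≡⟨ toBool-fromBool c ⟩
    c                  ∎)
    where open ≡-Reasoning

  terminatesᵇ : Exp nA nP → Bool
  terminatesᵇ e = does (terminates? (branching e))

  allTerminate : List (Fin n) → Bool → Bool
  allTerminate is b = foldr (_∧_ ∘ terminatesᵇ ∘ U[_]) b is

  allTerminate-true : ∀ is → allTerminate is true ≡ true ⇔ All _↓ (map U[_] is)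
  allTerminate-true []       = mk⇔ (λ _ → []) (λ _ → refl)
  allTerminate-true (i ∷ is) with terminates? (branching U[ i ])
  ... | yes U[i]↓ = mk⇔ (λ rest → U[i]↓ ∷ Equivalence.to (allTerminate-true is) rest)
                      (λ { (_ ∷ rest) → Equivalence.from (allTerminate-true is) rest })
  ... | no U[i]↑  = mk⇔ (λ ()) (λ { (U[i]↓ ∷ _) → ⊥-elim (U[i]↑ U[i]↓) })

  -- The flag of a cell is the control state to restore when it is popped: whether all components
  -- below it terminate.
  cells : Bool → List (Fin n) → List (Fin nData)
  cells b []       = []
  cells b (i ∷ is) = cell i (allTerminate is b) ∷ cells b is

  cells-++ : ∀ b qs ps → cells b (qs ++ ps) ≡ cells (allTerminate ps b) qs ++ cells b ps
  cells-++ b []       ps = refl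
  cells-++ b (q ∷ qs) ps = cong₂ _∷_ (cong (cell q) (foldr-++ _ b qs ps)) (cells-++ b qs ps)

  Config : Set
  Config = Fin 2 × List (Fin nData)

  config : List (Fin n) → Config
  config ps = fromBool (allTerminate ps true) , cells true ps ++ bottom ∷ []

  config-++ : ∀ qs ps → let b = allTerminate ps true in
              config (qs ++ ps) ≡ (fromBool (allTerminate qs b) , cells b qs ++ proj₂ (config ps))
  config-++ qs ps = cong₂ _,_
    (cong fromBool (foldr-++ _ true qs ps))
    (trans (cong (_++ bottom ∷ []) (cells-++ true qs ps))
           (++-assoc (cells _ qs) (cells true ps) (bottom ∷ [])))

  Rule : Set
  Rule = Fin 2 × Label (Fin nA) × Maybe (Fin nData) × List (Fin nData) × Fin 2

  startState : Fin 2
  startState = fromBool (terminatesᵇ (var X))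

  startRule : Label (Fin nA) → List (Fin n) → Rule
  startRule a qs = startState , a , nothing , proj₂ (config qs) , proj₁ (config qs)

  popRule : Fin 2 → Fin n → Bool → Label (Fin nA) → List (Fin n) → Rule
  popRule s i b a qs = s , a , just (cell i b) , cells b qs , fromBool (allTerminate qs b)

  rulesFor : e ∈ U → (Label (Fin nA) → List (Fin n) → Rule) → List Rule
  rulesFor {e} e∈U rule =
    mapWith∈ (steps (branching e)) λ {step} k →
      rule (proj₁ step) (targetCells e∈U (steps-sound (branching e) k))

  bools : List Bool
  bools = false ∷ true ∷ []

  popRulesAt : Fin n → Bool → Fin 2 → List Rule
  popRulesAt i b s = rulesFor (∈-lookup i) (popRule s i b)

  popRulesFor : Fin n → Bool → List Rule
  popRulesFor i b = concatMap (popRulesAt i b) (allFin 2)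

  popRulesOf : Fin n → List Rule
  popRulesOf i = concatMap (popRulesFor i) bools

  popRules : List Rule
  popRules = concatMap popRulesOf (allFin n)

  rules : List Rule
  rules = rulesFor var∈U startRule ++ popRules

  pda : PDA nA
  pda = record { nS = 2 ; nD = nData ; trans = rules ; init = startState ; final = toBool }

  rulesFor-complete : (e∈U : e ∈ U) (rule : Label (Fin nA) → List (Fin n) → Rule) → e ⟶[ a ] r →
                      ∃ λ qs → map U[_] qs ≡ dropTrivial (toList (spine r)) × rule a qs ∈ rulesFor e∈U rule
  rulesFor-complete {e} e∈U rule t =
    _ , lookup-targetCells e∈U _ , mapWith∈⁺ _ (_ , steps-complete (branching e) t , refl)

  rulesFor-sound : ∀ {e∈U : e ∈ U} {rule ρ} → ρ ∈ rulesFor e∈U rule →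
                   ∃ λ a → ∃ λ r → ∃ λ qs → e ⟶[ a ] r × map U[_] qs ≡ dropTrivial (toList (spine r)) ×
                   ρ ≡ rule a qs
  rulesFor-sound {e} {e∈U} k with mapWith∈⁻ (steps (branching e)) _ k
  ... | (a , r) , k′ , refl = a , r , _ , steps-sound (branching e) k′ , lookup-targetCells e∈U _ , refl

  start-complete : var X ⟶[ a ] r →
                   ∃ λ qs → map U[_] qs ≡ dropTrivial (toList (spine r)) × startRule a qs ∈ rules
  start-complete t with rulesFor-complete var∈U startRule t
  ... | qs , qs≡ , k = qs , qs≡ , ∈-++⁺ˡ k

  pop-complete : ∀ s {i} b → U[ i ] ⟶[ a ] r →
                 ∃ λ qs → map U[_] qs ≡ dropTrivial (toList (spine r)) × popRule s i b a qs ∈ rules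
  pop-complete s {i} b t with rulesFor-complete (∈-lookup i) (popRule s i b) t
  ... | qs , qs≡ , k = qs , qs≡ , ∈-++⁺ʳ (rulesFor var∈U startRule)
    (∈-concatMap⁺ popRulesOf (lose (∈-allFin i)
      (∈-concatMap⁺ (popRulesFor i) (lose (bool∈ b)
        (∈-concatMap⁺ (popRulesAt i b) (lose (∈-allFin s) k))))))
    where
    bool∈ : ∀ b → b ∈ bools
    bool∈ false = here refl
    bool∈ true  = there (here refl)

  popRules-sound : ∀ {ρ} → ρ ∈ popRules → ∃ λ s → ∃ λ i → ∃ λ b → ∃ λ a → ∃ λ r → ∃ λ qs →
                   U[ i ] ⟶[ a ] r × map U[_] qs ≡ dropTrivial (toList (spine r)) × ρ ≡ popRule s i b a qs
  popRules-sound k with find (∈-concatMap⁻ popRulesOf {xs = allFin n} k)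
  ... | i , _ , k′ with find (∈-concatMap⁻ (popRulesFor i) {xs = bools} k′)
  ... | b , _ , k″ with find (∈-concatMap⁻ (popRulesAt i b) {xs = allFin 2} k″)
  ... | s , _ , k‴ with rulesFor-sound {rule = popRule s i b} k‴
  ... | a , r , qs , t , qs≡ , ρ≡ = s , i , b , a , r , qs , t , qs≡ , ρ≡

  nothing∉popRules : ∀ {s w s′} → ¬ (s , a , nothing , w , s′) ∈ popRules
  nothing∉popRules k = case popRules-sound k of λ { (_ , _ , _ , _ , _ , _ , _ , _ , ()) }

  start-sound : ∀ {s w s′} → (s , a , nothing , w , s′) ∈ rules →
                ∃ λ r → ∃ λ qs → var X ⟶[ a ] r × map U[_] qs ≡ dropTrivial (toList (spine r)) ×
                (s′ , w) ≡ config qs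
  start-sound k = case ∈-++⁻ (rulesFor var∈U startRule) {popRules} k of λ
    { (inj₁ k′) → case rulesFor-sound {e∈U = var∈U} {rule = startRule} k′ of λ
        { (_ , r , qs , t , qs≡ , refl) → r , qs , t , qs≡ , refl }
    ; (inj₂ k′) → ⊥-elim (nothing∉popRules k′)
    }

  pop-sound : ∀ {s d w s′} → (s , a , just d , w , s′) ∈ rules →
              ∃ λ i → ∃ λ b → ∃ λ r → ∃ λ qs → d ≡ cell i b × U[ i ] ⟶[ a ] r ×
              map U[_] qs ≡ dropTrivial (toList (spine r)) × w ≡ cells b qs × s′ ≡ fromBool (allTerminate qs b)
  pop-sound k = case ∈-++⁻ (rulesFor var∈U startRule) {popRules} k of λ
    { (inj₁ k′) → case rulesFor-sound {e∈U = var∈U} {rule = startRule} k′ of λ { (_ , _ , _ , _ , _ , ()) }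
    ; (inj₂ k′) → case popRules-sound k′ of λ
        { (_ , i , b , _ , r , qs , t , qs≡ , refl) → i , b , r , qs , refl , t , qs≡ , refl , refl }
    }

  infix 4 _∼_
  data _∼_ : Config → Exp nA nP → Set where
    start : (startState , []) ∼ var X
    stack : ∀ {ps} xs → map U[_] ps ≡ dropTrivial (toList xs) → config ps ∼ seq⁺ xs

  ∼-spine : ∀ {qs} → map U[_] qs ≡ dropTrivial (toList (spine r)) → config qs ∼ r
  ∼-spine {r} qs≡ = subst (config _ ∼_) (seq⁺-spine r) (stack (spine r) qs≡)

  ∼-seq : ∀ {qs ps post} → map U[_] qs ≡ dropTrivial (toList (spine r)) → map U[_] ps ≡ dropTrivial post →
          config (qs ++ ps) ∼ seq r post
  ∼-seq {r} {qs} {ps} {post} qs≡ ps≡ = subst (config (qs ++ ps) ∼_) seq≡ (stack (spine r ⁺++ post) cells≡)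
    where
    seq≡ : seq⁺ (spine r ⁺++ post) ≡ seq r post
    seq≡ = trans (seq⁺-⁺++ (spine r) post) (cong (λ e → seq e post) (seq⁺-spine r))

    cells≡ : map U[_] (qs ++ ps) ≡ dropTrivial (toList (spine r) ++ post)
    cells≡ = begin
      map U[_] (qs ++ ps)                                  ≡⟨ map-++ U[_] qs ps ⟩
      map U[_] qs ++ map U[_] ps                              ≡⟨ cong₂ _++_ qs≡ ps≡ ⟩
      dropTrivial (toList (spine r)) ++ dropTrivial post ≡⟨ filter-++ active? (toList (spine r)) post ⟨
      dropTrivial (toList (spine r) ++ post)            ∎
      where open ≡-Reasoning

  ∼-expStep : ∀ {c e a e′} → c ∼ e → e ⟶[ a ] e′ → Σ Config λ c′ → PStep pda c a c′ × c′ ∼ e′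
  ∼-expStep start t with start-complete t
  ... | qs , qs≡ , k = config qs , k , ∼-spine qs≡
  ∼-expStep (stack {[]} (x ∷ zs) none) t = ⊥-elim (proj₂ (dropTrivial-≡[] x zs (sym none)) _ _ t)
  ∼-expStep (stack {i ∷ ps} (x ∷ zs) first) t with dropTrivial-≡∷ x zs (sym first)
  ... | post , active , x⨾zs≃ , rest with seq-step⁻ post active (Equivalence.to (steps-⇔ x⨾zs≃) t)
  ... | f′ , tf , refl with pop-complete (proj₁ (config (i ∷ ps))) (allTerminate ps true) tf
  ... | qs , qs≡ , k =
    _ , (cells _ qs , k , refl) ,
    subst (_∼ seq f′ post) (config-++ qs ps) (∼-seq {f′} {post = post} qs≡ (sym rest))

  ∼-pdaStep : ∀ {c e a c′} → c ∼ e → PStep pda c a c′ → Σ (Exp nA nP) λ e′ → e ⟶[ a ] e′ × c′ ∼ e′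
  ∼-pdaStep start k with start-sound k
  ... | r , qs , t , qs≡ , c′≡ = r , t , subst (_∼ r) (sym c′≡) (∼-spine qs≡)
  ∼-pdaStep (stack {[]} (x ∷ zs) _) (_ , k , _) with pop-sound k
  ... | _ , _ , _ , _ , () , _
  ∼-pdaStep {c′ = _ , _} (stack {i ∷ ps} (x ∷ zs) first) (_ , k , refl) with pop-sound k
  ... | _ , _ , r , qs , top≡ , t , qs≡ , refl , refl with cell-injective top≡
  ... | refl , refl with dropTrivial-≡∷ x zs (sym first)
  ... | post , _ , x⨾zs≃ , rest =
    seq r post , Equivalence.from (steps-⇔ x⨾zs≃) (seq-step⁺ post t) ,
    subst (_∼ seq r post) (config-++ qs ps) (∼-seq {r} {post = post} qs≡ (sym rest))

  accept : ∀ {c e} → c ∼ e → toBool (proj₁ c) ≡ true ⇔ e ↓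
  accept start rewrite toBool-fromBool (terminatesᵇ (var X)) = does-≡-true (terminates? (branching (var X)))
  accept (stack {ps} (x ∷ zs) ps≡) rewrite toBool-fromBool (allTerminate ps true) =
    ⇔.trans (allTerminate-true ps)
      (⇔.trans (mk⇔ (subst (All _↓) ps≡) (subst (All _↓) (sym ps≡)))
        (⇔.trans All-↓-dropTrivial (⇔.sym (seq-↓ zs))))

  bisimulation : IsBisimulationBetween (pdaGraph pda) (expGraph m (var X)) _∼_
  bisimulation = record { forth = ∼-pdaStep ; back = ∼-expStep ; accept = accept }

theorem6p9 : (nA nP : ℕ) (Δ : Spec nA nP) → Guarded Δ → (m : SOSModel Δ) → (X : Fin nP) →
    Σ (PDA nA) λ M → (nS M ≤ 2) × Bisimilar (pdaGraph M) (expGraph m (var X))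
theorem6p9 nA nP Δ guarded m X = pda , s≤s (s≤s z≤n) , bisimilar _ _ bisimulation start
  where
  open Construction guarded m (specSubterms Δ) (specSubterms-closed Δ) (body-⊆-specSubterms Δ)
                    X (var∈specSubterms Δ X)
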